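{- Let $k\ge 2$ be an integer and consider a $k\times(k+1)$ rectangle of tiles, with tiles labeled $(i,j)$, $1\le i\le k$, $1\le j\le k+1$. Let $\sigma_{\sf L}$ and $\sigma_{\sf R}$ be the permutations of the tiles given by $$\sigma_{\sf L}(i,j)=\begin{cases}(j,k+1-i) & j\neq k+1\\ (i,k+1) & j=k+1\end{cases},\qquad \sigma_{\sf R}(i,j)=\begin{cases}(j-1,k+2-i) & j\neq 1\\ (i,1) & j=1\end{cases}.$$ Then the group $G=\langle \sigma_{\sf L},\sigma_{\sf R}\rangle$ is doubly transitive on each of its orbits on the set of tiles.
   Context: Tile $(i,j)$ is in row $i$ (counted from the top) and column $j$ (counted from the left), so $(1,1)$ is the upper left corner. $\sigma_{\sf L}$ is the clockwise $90^\circ$ rotation of the left $k\times k$ square (columns $1,\dots,k$) and $\sigma_{\sf R}$ is the clockwise $90^\circ$ rotation of the right $k\times k$ square (columns $2,\dots,k+1$). A permutation group acting on a set $X$ is doubly transitive if it is transitive on $X$ and the stabilizer of some point $x\in X$ is transitive on $X\setminus\{x\}$. -}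

module Defs where

open import Data.Nat as ℕ using (ℕ; suc; _≥_)
open import Data.Fin using (Fin; zero; suc; toℕ; lower₁; inject₁; opposite)
open import Data.Product using (_×_; _,_; ∃-syntax)
open import Data.List using (List; []; _∷_)
open import Relation.Binary.PropositionalEquality using (_≡_; _≢_; sym)
open import Relation.Nullary using (yes; no)

-- Tiles of the k × (k+1) rectangle, 0-indexed:
-- the pair (i , j) : Fin k × Fin (k+1) is the paper's tile (i+1 , j+1).
Tile : ℕ → Set
Tile k = Fin k × Fin (suc k)

-- σ_L(i,j) = (j, k+1-i) if j ≠ k+1, and (i,k+1) if j = k+1  (1-indexed).
-- 0-indexed: (i,j) ↦ (j, k-1-i) if j ≠ k, fixed if j = k.
σL : ∀ {k} → Tile k → Tile k
σL {k} (i , j) with toℕ j ℕ.≟ k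
... | yes _ = (i , j)
... | no p  = (lower₁ j (λ e → p (sym e)) , inject₁ (opposite i))

-- σ_R(i,j) = (j-1, k+2-i) if j ≠ 1, and (i,1) if j = 1  (1-indexed).
-- 0-indexed: (i,0) fixed; (i, j+1) ↦ (j, k-i).
σR : ∀ {k} → Tile k → Tile k
σR (i , zero)  = (i , zero)
σR (i , suc j) = (j , suc (opposite i))

σL⁻¹ : ∀ {k} → Tile k → Tile k
σL⁻¹ {k} (a , b) with toℕ b ℕ.≟ k
... | yes _ = (a , b)
... | no p  = (opposite (lower₁ b (λ e → p (sym e))) , inject₁ a)

σR⁻¹ : ∀ {k} → Tile k → Tile k
σR⁻¹ (a , zero)  = (a , zero)
σR⁻¹ (a , suc b) = (opposite b , suc a)

data Gen : Set where
  L R L⁻ R⁻ : Gen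

gen : ∀ {k} → Gen → Tile k → Tile k
gen L  = σL
gen R  = σR
gen L⁻ = σL⁻¹
gen R⁻ = σR⁻¹

-- Elements of G are represented by words in the generators and their
-- inverses; a word acts by applying its letters right-to-left
-- (act (g ∷ w) = gen g ∘ act w).  Every element of G is of this form.
act : ∀ {k} → List Gen → Tile k → Tile k
act []      t = t
act (g ∷ w) t = gen g (act w t)

InOrbit : ∀ {k} → Tile k → Tile k → Set
InOrbit x y = ∃[ w ] act w x ≡ y

DoublyTransitiveOnOrbitOf : ∀ {k} → Tile k → Set
DoublyTransitiveOnOrbitOf {k} t =
  (∀ (y z : Tile k) → InOrbit t y → InOrbit t z → ∃[ w ] act w y ≡ z)
  × ∃[ x ] (InOrbit t x ×
      (∀ (y z : Tile k) → InOrbit t y → InOrbit t z → y ≢ x → z ≢ x →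
         ∃[ w ] (act w x ≡ x × act w y ≡ z)))

module Submission where

-- Write k = m + 2, let x = (0, k) be the top-right tile, which σ_L fixes,
-- and ρ the left-right reflection, so that ρ x = (0, 0).
--
-- 1. Each generator and its inverse is described by an explicit coordinate
--    formula; from these follow the inverse laws, hence words act as a
--    group and orbits and stabiliser-orbits are equivalence relations.
-- 2. Double transitivity on an orbit reduces to one base point x in it:
--    it suffices that the stabiliser G_x is transitive on (G·x) ∖ {x}.
-- 3. ρ conjugates σ_L to σ_R⁻¹ and σ_R to σ_L⁻¹, so it transports this
--    property from x to ρ x.
-- 4. G_x contains σ_L and σ_L σ_R⁻¹ σ_L⁻¹ σ_R, which shifts every tile
--    outside row 0 two columns to the left; with these G_x moves every
--    tile y ≠ x to (1, 0) or (1, 1).  For even k these two tiles are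
--    G_x-equivalent; for odd k the parity of row + column is G-invariant
--    and excludes (1, 1) from G·x.  So G_x is transitive on (G·x) ∖ {x}.
-- 5. The same navigation shows that every tile lies in G·x or G·(ρ x),
--    and the theorem follows from 2 and 3.

open import Defs
open import Data.Nat as ℕ using (ℕ; zero; suc; _+_; _≤_; _<_; _≥_; z≤n; s≤s; parity)
open import Data.Nat.Properties as ℕP using ()
open import Data.Fin as F using (Fin; toℕ; opposite)
open import Data.Fin.Properties as FP using (toℕ-injective; toℕ<n)
open import Data.Parity.Base as ℙ using (Parity; 0ℙ; 1ℙ)
open import Data.Parity.Properties as ℙP using ()
open import Data.Product using (_×_; _,_; ∃-syntax; proj₁; proj₂)
open import Data.Product.Properties using (≡-dec)
open import Data.Sum using (_⊎_; inj₁; inj₂)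
open import Data.List using (List; []; _∷_; _++_; map)
open import Function using (_∘_)
open import Relation.Binary.PropositionalEquality
open import Relation.Nullary using (yes; no)
open import Relation.Nullary.Negation using (contradiction)

complement : ∀ {a k} → a < k → ∃[ c ] suc (a + c) ≡ k
complement a<k = ℕP.m≤n⇒∃[o]m+o≡n a<k

complement-comm : ∀ a c {k} → suc (a + c) ≡ k → suc (c + a) ≡ k
complement-comm a c e = trans (cong suc (ℕP.+-comm c a)) e

complement-< : ∀ {a c k} → suc (a + c) ≡ k → c < k
complement-< {a} {c} refl = s≤s (ℕP.m≤n+m c a)

opposite-complement : ∀ {n c} (i : Fin n) → suc (toℕ i + c) ≡ n → toℕ (opposite i) ≡ c
opposite-complement {n} {c} i e = trans (FP.opposite-prop i)
  (ℕP.+-cancelˡ-≡ (suc (toℕ i)) _ _ (trans (ℕP.m+[n∸m]≡n (toℕ<n i)) (sym e)))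

At : ∀ {k} → Tile k → ℕ → ℕ → Set
At (i , j) a b = toℕ i ≡ a × toℕ j ≡ b

at : ∀ {k} (p : Tile k) → At p (toℕ (proj₁ p)) (toℕ (proj₂ p))
at (i , j) = refl , refl

at-unique : ∀ {k} {p q : Tile k} {a b} → At p a b → At q a b → p ≡ q
at-unique {p = i , j} {i' , j'} (refl , refl) (e , e') =
  cong₂ _,_ (toℕ-injective (sym e)) (toℕ-injective (sym e'))

at-row< : ∀ {k} {p : Tile k} {a b} → At p a b → a < k
at-row< {p = i , j} (refl , _) = toℕ<n i

at-col≤ : ∀ {k} {p : Tile k} {a b} → At p a b → b ≤ k
at-col≤ {p = i , j} (_ , refl) = ℕ.s≤s⁻¹ (toℕ<n j)

last-or-< : ∀ {b k} → b ≤ k → b ≡ k ⊎ b < k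
last-or-< b≤k with ℕP.m≤n⇒m<n∨m≡n b≤k
... | inj₁ b<k = inj₂ b<k
... | inj₂ b≡k = inj₁ b≡k

σL-at : ∀ {k} (p : Tile k) {a b c} → At p a b → b < k → suc (a + c) ≡ k → At (σL p) b c
σL-at {k} (i , j) (refl , refl) b<k e with toℕ j ℕ.≟ k
... | yes j≡k = contradiction j≡k (ℕP.<⇒≢ b<k)
... | no _    = FP.toℕ-lower₁ j _ , trans (FP.toℕ-inject₁ _) (opposite-complement i e)

σL-fix : ∀ {k} (p : Tile k) {a} → At p a k → σL p ≡ p
σL-fix {k} (i , j) (_ , j≡k) with toℕ j ℕ.≟ k
... | yes _   = refl
... | no j≢k  = contradiction j≡k j≢k

σL⁻¹-at : ∀ {k} (p : Tile k) {a b c} → At p a b → b < k → suc (b + c) ≡ k → At (σL⁻¹ p) c a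
σL⁻¹-at {k} (i , j) (refl , refl) b<k e with toℕ j ℕ.≟ k
... | yes j≡k = contradiction j≡k (ℕP.<⇒≢ b<k)
... | no _    = opposite-complement (F.lower₁ j _) (subst (λ z → suc (z + _) ≡ k) (sym (FP.toℕ-lower₁ j _)) e)
              , FP.toℕ-inject₁ i

σL⁻¹-fix : ∀ {k} (p : Tile k) {a} → At p a k → σL⁻¹ p ≡ p
σL⁻¹-fix {k} (i , j) (_ , j≡k) with toℕ j ℕ.≟ k
... | yes _   = refl
... | no j≢k  = contradiction j≡k j≢k

σR-at : ∀ {k} (p : Tile k) {a b c} → At p a (suc b) → suc (a + c) ≡ k → At (σR p) b (suc c)
σR-at (i , F.suc j) (refl , refl) e = refl , cong suc (opposite-complement i e)

σR-fix : ∀ {k} (p : Tile k) {a} → At p a 0 → σR p ≡ p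
σR-fix (i , F.zero) _ = refl

σR⁻¹-at : ∀ {k} (p : Tile k) {a b c} → At p a (suc b) → suc (b + c) ≡ k → At (σR⁻¹ p) c (suc a)
σR⁻¹-at (i , F.suc j) (refl , refl) e = opposite-complement j e , refl

σR⁻¹-fix : ∀ {k} (p : Tile k) {a} → At p a 0 → σR⁻¹ p ≡ p
σR⁻¹-fix (i , F.zero) _ = refl

σL⁻¹-σL : ∀ {k} (p : Tile k) → σL⁻¹ (σL p) ≡ p
σL⁻¹-σL p with last-or-< (at-col≤ (at p))
... | inj₁ b≡k = trans (cong σL⁻¹ (σL-fix p (refl , b≡k))) (σL⁻¹-fix p (refl , b≡k))
... | inj₂ b<k with complement (at-row< (at p))
... | c , e = at-unique (σL⁻¹-at (σL p) (σL-at p (at p) b<k e) (complement-< e) (complement-comm _ c e)) (at p)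

σL-σL⁻¹ : ∀ {k} (p : Tile k) → σL (σL⁻¹ p) ≡ p
σL-σL⁻¹ p with last-or-< (at-col≤ (at p))
... | inj₁ b≡k = trans (cong σL (σL⁻¹-fix p (refl , b≡k))) (σL-fix p (refl , b≡k))
... | inj₂ b<k with complement b<k
... | c , e = at-unique (σL-at (σL⁻¹ p) (σL⁻¹-at p (at p) b<k e) (at-row< (at p)) (complement-comm _ c e)) (at p)

σR⁻¹-σR : ∀ {k} (p : Tile k) → σR⁻¹ (σR p) ≡ p
σR⁻¹-σR (i , F.zero)  = refl
σR⁻¹-σR (i , F.suc j) with complement (toℕ<n i)
... | c , e = at-unique (σR⁻¹-at _ (σR-at (i , F.suc j) (refl , refl) e) (complement-comm _ c e)) (refl , refl)

σR-σR⁻¹ : ∀ {k} (p : Tile k) → σR (σR⁻¹ p) ≡ p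
σR-σR⁻¹ (i , F.zero)  = refl
σR-σR⁻¹ (i , F.suc j) with complement (ℕ.s≤s⁻¹ (toℕ<n (F.suc j)))
... | c , e = at-unique (σR-at _ (σR⁻¹-at (i , F.suc j) (refl , refl) e) (complement-comm _ c e)) (refl , refl)

gen-inverse : Gen → Gen
gen-inverse L  = L⁻
gen-inverse R  = R⁻
gen-inverse L⁻ = L
gen-inverse R⁻ = R

gen-inverse-cancel : ∀ {k} g (p : Tile k) → gen (gen-inverse g) (gen g p) ≡ p
gen-inverse-cancel L  = σL⁻¹-σL
gen-inverse-cancel R  = σR⁻¹-σR
gen-inverse-cancel L⁻ = σL-σL⁻¹
gen-inverse-cancel R⁻ = σR-σR⁻¹

inverse : List Gen → List Gen
inverse []      = []
inverse (g ∷ w) = inverse w ++ (gen-inverse g ∷ [])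

act-++ : ∀ {k} u v (p : Tile k) → act (u ++ v) p ≡ act u (act v p)
act-++ []      v p = refl
act-++ (g ∷ u) v p = cong (gen g) (act-++ u v p)

act-inverse : ∀ {k} w (p : Tile k) → act (inverse w) (act w p) ≡ p
act-inverse []      p = refl
act-inverse (g ∷ w) p = begin
  act (inverse w ++ (gen-inverse g ∷ [])) (gen g (act w p)) ≡⟨ act-++ (inverse w) _ _ ⟩
  act (inverse w) (gen (gen-inverse g) (gen g (act w p)))   ≡⟨ cong (act (inverse w)) (gen-inverse-cancel g _) ⟩
  act (inverse w) (act w p)                                 ≡⟨ act-inverse w p ⟩
  p                                                         ∎
  where open ≡-Reasoning

orbit-refl : ∀ {k} (p : Tile k) → InOrbit p p
orbit-refl p = [] , refl

orbit-trans : ∀ {k} {p q r : Tile k} → InOrbit p q → InOrbit q r → InOrbit p r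
orbit-trans {p = p} (u , refl) (v , refl) = v ++ u , act-++ v u p

orbit-sym : ∀ {k} {p q : Tile k} → InOrbit p q → InOrbit q p
orbit-sym {p = p} (u , refl) = inverse u , act-inverse u p

Stab : ∀ {k} → Tile k → Tile k → Tile k → Set
Stab x y z = ∃[ w ] (act w x ≡ x × act w y ≡ z)

stab-refl : ∀ {k} {x : Tile k} y → Stab x y y
stab-refl y = [] , refl , refl

stab-trans : ∀ {k} {x p q r : Tile k} → Stab x p q → Stab x q r → Stab x p r
stab-trans {x = x} {p} (u , ux , refl) (v , vx , refl) =
  v ++ u , trans (act-++ v u x) (trans (cong (act v) ux) vx) , act-++ v u p

stab-sym : ∀ {k} {x p q : Tile k} → Stab x p q → Stab x q p
stab-sym {x = x} {p} (u , ux , refl) =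
  inverse u , trans (cong (act (inverse u)) (sym ux)) (act-inverse u x) , act-inverse u p

stab-orbit : ∀ {k} {x p q : Tile k} → Stab x p q → InOrbit p q
stab-orbit (w , _ , e) = w , e

StabTransitive : ∀ {k} → Tile k → Set
StabTransitive {k} x = ∀ (y z : Tile k) → InOrbit x y → InOrbit x z → y ≢ x → z ≢ x → Stab x y z

doublyTransitive : ∀ {k} {t x : Tile k} → InOrbit t x → StabTransitive x → DoublyTransitiveOnOrbitOf t
doublyTransitive {t = t} {x} tx stab =
  (λ y z ty tz → orbit-trans (orbit-sym ty) tz) ,
  x , tx , λ y z ty tz → stab y z (from-x ty) (from-x tz)
  where
    from-x : ∀ {y} → InOrbit t y → InOrbit x y
    from-x ty = orbit-trans (orbit-sym tx) ty

mirror : ∀ {k} → Tile k → Tile k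
mirror (i , j) = (i , opposite j)

mirror-at : ∀ {k} {p : Tile k} {a b c} → At p a b → b + c ≡ k → At (mirror p) a c
mirror-at {p = i , j} (ea , refl) e = ea , opposite-complement j (cong suc e)

mirror-involutive : ∀ {k} (p : Tile k) → mirror (mirror p) ≡ p
mirror-involutive (i , j) = cong (i ,_) (FP.opposite-involutive j)

mirror-σL : ∀ {k} (p : Tile k) → mirror (σL p) ≡ σR⁻¹ (mirror p)
mirror-σL p with last-or-< (at-col≤ (at p))
... | inj₁ b≡k = trans (cong mirror (σL-fix p (refl , b≡k)))
                       (sym (σR⁻¹-fix (mirror p) (mirror-at (at p) (trans (ℕP.+-identityʳ _) b≡k))))
... | inj₂ b<k with complement (at-row< (at p)) | complement b<k
... | c , e | c' , e' = at-unique
      (mirror-at (σL-at p (at p) b<k e) (trans (ℕP.+-suc c _) (complement-comm _ c e)))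
      (σR⁻¹-at (mirror p) (mirror-at (at p) (trans (ℕP.+-suc _ c') e')) (complement-comm _ c' e'))

mirror-σR : ∀ {k} (p : Tile k) → mirror (σR p) ≡ σL⁻¹ (mirror p)
mirror-σR (i , F.zero)  = sym (σL⁻¹-fix (mirror (i , F.zero)) (mirror-at {p = i , F.zero} (refl , refl) refl))
mirror-σR (i , F.suc j) with complement (toℕ<n i) | ℕP.m≤n⇒∃[o]m+o≡n (ℕ.s≤s⁻¹ (toℕ<n (F.suc j)))
... | c , e | c' , e' = at-unique
      (mirror-at (σR-at (i , F.suc j) (refl , refl) e) (complement-comm _ c e))
      (σL⁻¹-at _ (mirror-at {p = i , F.suc j} (refl , refl) e') (complement-< e') (complement-comm _ c' e'))

mirror-gen : Gen → Gen
mirror-gen L  = R⁻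
mirror-gen R  = L⁻
mirror-gen L⁻ = R
mirror-gen R⁻ = L

gen-mirror : ∀ {k} g (p : Tile k) → gen (mirror-gen g) (mirror p) ≡ mirror (gen g p)
gen-mirror L  p = sym (mirror-σL p)
gen-mirror R  p = sym (mirror-σR p)
gen-mirror L⁻ p = begin
  σR (mirror p)               ≡⟨ cong (σR ∘ mirror) (sym (σL-σL⁻¹ p)) ⟩
  σR (mirror (σL (σL⁻¹ p)))   ≡⟨ cong σR (mirror-σL (σL⁻¹ p)) ⟩
  σR (σR⁻¹ (mirror (σL⁻¹ p))) ≡⟨ σR-σR⁻¹ _ ⟩
  mirror (σL⁻¹ p)             ∎
  where open ≡-Reasoning
gen-mirror R⁻ p = begin
  σL (mirror p)               ≡⟨ cong (σL ∘ mirror) (sym (σR-σR⁻¹ p)) ⟩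
  σL (mirror (σR (σR⁻¹ p)))   ≡⟨ cong σL (mirror-σR (σR⁻¹ p)) ⟩
  σL (σL⁻¹ (mirror (σR⁻¹ p))) ≡⟨ σL-σL⁻¹ _ ⟩
  mirror (σR⁻¹ p)             ∎
  where open ≡-Reasoning

act-mirror : ∀ {k} w (p : Tile k) → act (map mirror-gen w) (mirror p) ≡ mirror (act w p)
act-mirror []      p = refl
act-mirror (g ∷ w) p = trans (cong (gen (mirror-gen g)) (act-mirror w p)) (gen-mirror g (act w p))

mirror-orbit : ∀ {k} {p q : Tile k} → InOrbit p q → InOrbit (mirror p) (mirror q)
mirror-orbit {p = p} (w , refl) = map mirror-gen w , act-mirror w p

mirror-stab : ∀ {k} {x p q : Tile k} → Stab x p q → Stab (mirror x) (mirror p) (mirror q)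
mirror-stab {x = x} {p} (w , wx , refl) =
  map mirror-gen w , trans (act-mirror w x) (cong mirror wx) , act-mirror w p

mirror-stabTransitive : ∀ {k} {x : Tile k} → StabTransitive x → StabTransitive (mirror x)
mirror-stabTransitive {x = x} stab y z xy xz y≢ z≢ =
  subst₂ (Stab (mirror x)) (mirror-involutive y) (mirror-involutive z)
    (mirror-stab (stab (mirror y) (mirror z) (back xy) (back xz) (avoid y≢) (avoid z≢)))
  where
    back : ∀ {q} → InOrbit (mirror x) q → InOrbit x (mirror q)
    back xq = subst (λ p → InOrbit p _) (mirror-involutive x) (mirror-orbit xq)
    avoid : ∀ {q} → q ≢ mirror x → mirror q ≢ x
    avoid q≢ e = q≢ (trans (sym (mirror-involutive _)) (cong mirror e))

weight : ∀ {k} → Tile k → Parity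
weight (i , j) = parity (toℕ i + toℕ j)

weight-at : ∀ {k} {p : Tile k} {a b} → At p a b → weight p ≡ parity (a + b)
weight-at {p = i , j} (refl , refl) = refl

even-complement : ∀ a c {k} → suc (a + c) ≡ k → parity k ≡ 1ℙ → parity (a + c) ≡ 0ℙ
even-complement a c e odd = begin
  parity (a + c)             ≡⟨ sym (ℙP.suc-homo-⁻¹ (a + c)) ⟩
  parity (suc (a + c)) ℙ.⁻¹  ≡⟨ cong ℙ._⁻¹ (trans (cong parity e) odd) ⟩
  0ℙ                         ∎
  where open ≡-Reasoning

parity-swap : ∀ a b c → parity (a + c) ≡ 0ℙ → parity (b + c) ≡ parity (a + b)
parity-swap a b c even = begin
  parity (b + c)          ≡⟨ ℙP.+-homo-+ b c ⟩
  parity b ℙ.+ parity c   ≡⟨ cong (parity b ℙ.+_) (sym a≡c) ⟩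
  parity b ℙ.+ parity a   ≡⟨ ℙP.+-comm (parity b) (parity a) ⟩
  parity a ℙ.+ parity b   ≡⟨ sym (ℙP.+-homo-+ a b) ⟩
  parity (a + b)          ∎
  where
    open ≡-Reasoning
    a≡c : parity a ≡ parity c
    a≡c = ℙP.+-cancelʳ-≡ (parity c) (parity a) (parity c)
            (trans (sym (ℙP.+-homo-+ a c)) (trans even (sym (ℙP.p+p≡0ℙ (parity c)))))

module OddWeight {k : ℕ} (odd : parity k ≡ 1ℙ) where

  weight-σL : (p : Tile k) → weight (σL p) ≡ weight p
  weight-σL (i , j) with last-or-< (at-col≤ {p = i , j} (refl , refl))
  ... | inj₁ b≡k = cong weight (σL-fix (i , j) (refl , b≡k))
  ... | inj₂ b<k with complement (toℕ<n i)
  ... | c , e = trans (weight-at (σL-at (i , j) (refl , refl) b<k e))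
                      (parity-swap (toℕ i) (toℕ j) c (even-complement (toℕ i) c e odd))

  weight-σR : (p : Tile k) → weight (σR p) ≡ weight p
  weight-σR (i , F.zero)  = refl
  weight-σR (i , F.suc j) with complement (toℕ<n i)
  ... | c , e = trans (weight-at (σR-at (i , F.suc j) (refl , refl) e))
                      (trans (cong parity (ℕP.+-suc (toℕ j) c))
                             (parity-swap (toℕ i) (suc (toℕ j)) c (even-complement (toℕ i) c e odd)))

  weight-gen : ∀ g (p : Tile k) → weight (gen g p) ≡ weight p
  weight-gen L  p = weight-σL p
  weight-gen R  p = weight-σR p
  weight-gen L⁻ p = trans (sym (weight-σL (σL⁻¹ p))) (cong weight (σL-σL⁻¹ p))
  weight-gen R⁻ p = trans (sym (weight-σR (σR⁻¹ p))) (cong weight (σR-σR⁻¹ p))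

  weight-orbit : ∀ {p q : Tile k} → InOrbit p q → weight q ≡ weight p
  weight-orbit ([]    , refl) = refl
  weight-orbit (g ∷ w , refl) = trans (weight-gen g (act w _)) (weight-orbit (w , refl))

module BasePoint (m : ℕ) where

  K : ℕ
  K = suc (suc m)

  x : Tile K
  x = (F.zero , F.fromℕ K)

  x-at : At x 0 K
  x-at = refl , FP.toℕ-fromℕ K

  -- The two tiles (1, 0) and (1, 1) to which G_x moves every y ≠ x.
  c₁₀ c₁₁ : Tile K
  c₁₀ = (F.suc F.zero , F.zero)
  c₁₁ = (F.suc F.zero , F.suc F.zero)

  fixing : ∀ w → act w x ≡ x → ∀ p → Stab x p (act w p)
  fixing w wx p = w , wx , refl

  σL-stab : ∀ p → Stab x p (σL p)
  σL-stab = fixing (L ∷ []) (σL-fix x x-at)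

  σL⁻¹-stab : ∀ p → Stab x p (σL⁻¹ p)
  σL⁻¹-stab = fixing (L⁻ ∷ []) (σL⁻¹-fix x x-at)

  shift-left : List Gen
  shift-left = L ∷ R⁻ ∷ L⁻ ∷ R ∷ []

  shift-left-fix : act shift-left x ≡ x
  shift-left-fix = begin
    σL (σR⁻¹ (σL⁻¹ (σR x))) ≡⟨ cong (σL ∘ σR⁻¹) (σL⁻¹-fix (σR x) (σR-at x x-at refl)) ⟩
    σL (σR⁻¹ (σR x))        ≡⟨ cong σL (σR⁻¹-σR x) ⟩
    σL x                    ≡⟨ σL-fix x x-at ⟩
    x                       ∎
    where open ≡-Reasoning

  shift-left-at : ∀ {p a b} → At p (suc a) (suc (suc b)) → At (act shift-left p) (suc a) b
  shift-left-at {p} {a} {b} h with complement (at-row< h) | complement {b} (ℕP.≤-trans (ℕP.n≤1+n _) (at-col≤ h))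
  ... | c , e | c' , e' =
    σL-at _ (σR⁻¹-at _ (σL⁻¹-at _ (σR-at p h e) (complement-< e-suc) e-comm) e')
          (at-row< h) (complement-comm b c' e')
    where
      e-suc : suc (a + suc c) ≡ K
      e-suc = trans (cong suc (ℕP.+-suc a c)) e
      e-comm : suc (suc c + a) ≡ K
      e-comm = trans (cong (suc ∘ suc) (ℕP.+-comm c a)) e

  Reaches : Tile K → ℕ → ℕ → Set
  Reaches p a b = ∃[ q ] (Stab x p q × At q a b)

  reached : ∀ {p a b} → At p a b → Reaches p a b
  reached {p} h = p , stab-refl p , h

  via : ∀ {p q a b} → Stab x p q → Reaches q a b → Reaches p a b
  via pq (r , qr , h) = r , stab-trans pq qr , h

  reaches-tile : ∀ {p q a b} → Reaches p a b → At q a b → Stab x p q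
  reaches-tile (r , pr , h) h' = subst (Stab x _) (at-unique h h') pr

  residue : Parity → ℕ
  residue 0ℙ = 0
  residue 1ℙ = 1

  reduce : ∀ {p a b} → At p (suc a) b → Reaches p (suc a) (residue (parity b))
  reduce {b = 0}           h = reached h
  reduce {b = 1}           h = reached h
  reduce {p} {b = suc (suc b)} h = via (fixing shift-left shift-left-fix p) (reduce (shift-left-at h))

  Base : Tile K → Set
  Base p = Reaches p 1 0 ⊎ Reaches p 1 1

  base-via : ∀ {p q} → Stab x p q → Base q → Base p
  base-via pq (inj₁ r) = inj₁ (via pq r)
  base-via pq (inj₂ r) = inj₂ (via pq r)

  onward : ∀ {p a b} → Reaches p a b → (∀ {q} → At q a b → Base q) → Base p
  onward (q , pq , h) continue = base-via pq (continue h)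

  base-row1 : ∀ {p b} → At p 1 b → Base p
  base-row1 {b = b} h with parity b | reduce h
  ... | 0ℙ | r = inj₁ r
  ... | 1ℙ | r = inj₂ r

  base-col1 : ∀ {p a} → At p (suc a) 1 → Base p
  base-col1 {p} h with complement (at-row< h)
  ... | c , e = base-via (σL-stab p) (base-row1 (σL-at p h (s≤s (s≤s z≤n)) e))

  -- The bottom-left tile (k - 1, 0) goes to (1, k) under shift-left.
  base-corner : ∀ {p} → At p (suc m) 0 → Base p
  base-corner {p} h = base-via (fixing shift-left shift-left-fix p) (base-row1 at-shifted)
    where
      at-σR⁻¹ : At (σR⁻¹ (σL⁻¹ (σR p))) 1 K
      at-σR⁻¹ = σR⁻¹-at _ (σL⁻¹-at (σR p) (subst (λ q → At q _ _) (sym (σR-fix p h)) h) (s≤s z≤n) refl)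
                        (cong suc (ℕP.+-comm m 1))
      at-shifted : At (act shift-left p) 1 K
      at-shifted = subst (λ q → At q 1 K) (sym (σL-fix _ at-σR⁻¹)) at-σR⁻¹

  -- Column 0: σ_L⁻¹ moves the tile to row k - 1, then reduce.
  base-col0 : ∀ {p a} → At p (suc a) 0 → Base p
  base-col0 {p} {a} h with parity (suc a) | reduce (σL⁻¹-at p h (s≤s z≤n) refl)
  ... | 0ℙ | r = base-via (σL⁻¹-stab p) (onward r base-corner)
  ... | 1ℙ | r = base-via (σL⁻¹-stab p) (onward r to-row1)
    where
      to-row1 : ∀ {q} → At q (suc m) 1 → Base q
      to-row1 {q} hq = base-via (σL-stab q)
        (inj₁ (reached (σL-at q hq (s≤s (s≤s z≤n)) (cong (suc ∘ suc) (ℕP.+-identityʳ m)))))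

  base-lower : ∀ {p a b} → At p (suc a) b → Base p
  base-lower {b = b} h with parity b | reduce h
  ... | 0ℙ | r = onward r base-col0
  ... | 1ℙ | r = onward r base-col1

  -- Row 0: σ_L moves the tile out of row 0 (twice, for the corner (0, 0)).
  base-row0-suc : ∀ {p b} → At p 0 (suc b) → suc b < K → Base p
  base-row0-suc {p} h b<K = base-via (σL-stab p) (base-lower (σL-at p h b<K refl))

  base-row0 : ∀ {p b} → At p 0 b → b < K → Base p
  base-row0 {p} {suc b} h b<K = base-row0-suc h b<K
  base-row0 {p} {zero}  h _   = base-via (σL-stab p) (base-row0-suc (σL-at p h (s≤s z≤n) refl) ℕP.≤-refl)

  navigate : (p : Tile K) → p ≢ x → Base p
  navigate (F.suc i , j) _ = base-lower (refl , refl)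
  navigate (F.zero , j) p≢x with last-or-< (at-col≤ {p = F.zero , j} (refl , refl))
  ... | inj₁ j≡K = contradiction (at-unique (refl , j≡K) x-at) p≢x
  ... | inj₂ j<K = base-row0 (refl , refl) j<K

  -- For even k, (1, 1) and (1, 0) are G_x-equivalent: σ_L takes (1, 1)
  -- to (1, k - 2), and k - 2 is even.
  even-link : parity K ≡ 0ℙ → Stab x c₁₁ c₁₀
  even-link even = stab-trans (σL-stab c₁₁) (reaches-tile reaches-c₁₀ (refl , refl))
    where
      reaches-c₁₀ : Reaches (σL c₁₁) 1 0
      reaches-c₁₀ = subst (λ r → Reaches (σL c₁₁) 1 (residue r)) even
                          (reduce (σL-at c₁₁ (refl , refl) (s≤s (s≤s z≤n)) refl))

  odd-orbit : parity K ≡ 1ℙ → ∀ {y} → InOrbit x y → weight y ≡ 1ℙ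
  odd-orbit odd xy = trans (OddWeight.weight-orbit odd xy) (trans (weight-at x-at) odd)

  to-c₁₀ : ∀ {y} → InOrbit x y → y ≢ x → Stab x y c₁₀
  to-c₁₀ {y} xy y≢x with navigate y y≢x
  ... | inj₁ r = reaches-tile r (refl , refl)
  ... | inj₂ r with parity m in parity-K
  ...   | 0ℙ = stab-trans (reaches-tile r (refl , refl)) (even-link parity-K)
  ...   | 1ℙ = contradiction (trans (OddWeight.weight-orbit parity-K y→c₁₁) (odd-orbit parity-K xy)) λ ()
    where
      y→c₁₁ : InOrbit y c₁₁
      y→c₁₁ = stab-orbit (reaches-tile r (refl , refl))

  stabTransitive : StabTransitive x
  stabTransitive y z xy xz y≢x z≢x = stab-trans (to-c₁₀ xy y≢x) (stab-sym (to-c₁₀ xz z≢x))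

  c₁₀-to-x : InOrbit c₁₀ x
  c₁₀-to-x = R⁻ ∷ R⁻ ∷ L⁻ ∷ R ∷ [] , at-unique at-x x-at
    where
      at-x : At (σR⁻¹ (σR⁻¹ (σL⁻¹ (σR c₁₀)))) 0 K
      at-x = σR⁻¹-at _ (σR⁻¹-at _ (σL⁻¹-at c₁₀ (refl , refl) (s≤s z≤n) refl) refl)
                     (cong (suc ∘ suc) (ℕP.+-identityʳ m))

  c₁₁-to-mirror-x : InOrbit c₁₁ (mirror x)
  c₁₁-to-mirror-x = L⁻ ∷ R ∷ [] , at-unique at-corner (mirror-at x-at (ℕP.+-identityʳ K))
    where
      at-corner : At (σL⁻¹ (σR c₁₁)) 0 0
      at-corner = σL⁻¹-at _ (σR-at c₁₁ (refl , refl) refl) ℕP.≤-refl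
                          (cong (suc ∘ suc) (ℕP.+-identityʳ m))

  classify : (t : Tile K) → InOrbit t x ⊎ InOrbit t (mirror x)
  classify t with ≡-dec FP._≟_ FP._≟_ t x
  ... | yes refl = inj₁ (orbit-refl x)
  ... | no t≢x with navigate t t≢x
  ...   | inj₁ r = inj₁ (orbit-trans (stab-orbit (reaches-tile r (refl , refl))) c₁₀-to-x)
  ...   | inj₂ r = inj₂ (orbit-trans (stab-orbit (reaches-tile r (refl , refl))) c₁₁-to-mirror-x)

lemma1 : ∀ (k : ℕ) → k ≥ 2 → ∀ (t : Tile k) → DoublyTransitiveOnOrbitOf t
lemma1 (suc (suc m)) (s≤s (s≤s z≤n)) t with BasePoint.classify m t
... | inj₁ t→x  = doublyTransitive t→x (BasePoint.stabTransitive m)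
... | inj₂ t→ρx = doublyTransitive t→ρx (mirror-stabTransitive (BasePoint.stabTransitive m))
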